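{- Let $\mathcal{M}_1=\langle W_1,\leq_1,\mathbf{v},D_1,\phi_1\rangle$ and $\mathcal{M}_2=\langle W_2,\leq_2,\mathbf{w},D_2,\phi_2\rangle$ be G-models for the same language $L$, let $Z$ be a CD-asimulation between $\mathcal{M}_1$ and $\mathcal{M}_2$, and let $A[x_1,\dots,x_k]$ be a formula of $L$ whose free variables are among $x_1,\dots,x_k$. Let $\{i,j\}=\{1,2\}$, $t\in W_i$, $\vec d\in D_i^k$, $u\in W_j$, $\vec e\in D_j^k$. If $(t,\vec d)\,Z\,(u,\vec e)$ and $t\Vdash_i A[\vec d]$, then $u\Vdash_j A[\vec e]$.
   Context: A G-model is a structure $\langle W,\leq,\mathbf{w},D,\phi\rangle$ where $W$ is a non-empty set, $\leq$ a reflexive transitive relation on $W$, $\mathbf{w}\leq u$ for all $u\in W$, $D$ a non-empty set, and for each $k$-ary predicate symbol $P$, $\phi(P)\subseteq W\times D^k$ is monotone (if $u\leq w$ and $\langle u,\vec a\rangle\in\phi(P)$ then $\langle w,\vec a\rangle\in\phi(P)$). Formulas are built from atomic formulas and $\perp$ using $\wedge,\vee,\rightarrow,\forall,\exists$. Forcing: $u\Vdash P\vec a$ iff $\langle u,\vec a\rangle\in\phi(P)$; $\wedge,\vee$ locally; $u\Vdash A\rightarrow B$ iff for all $w\geq u$, $w\Vdash A$ implies $w\Vdash B$; $\perp$ never forced; $u\Vdash\exists xA$ (resp. $\forall xA$) iff $u\Vdash A[a/x]$ for some (resp. all) $a\in D$. $\Vdash_i$ denotes forcing in $\mathcal{M}_i$.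 A CD-asimulation between $\mathcal{M}_1$ and $\mathcal{M}_2$ is a relation $Z\subseteq\bigcup_{k\geq0}[(W_1\times D_1^k)\times(W_2\times D_2^k)]\cup[(W_2\times D_2^k)\times(W_1\times D_1^k)]$ such that for all $\{i,j\}=\{1,2\}$: (1) if $(v,\vec d)Z(w,\vec e)$ with $v\in W_i$ and $v\Vdash_i P[\vec d]$ for an atomic formula $P[\vec x]$ (with variables among $x_1,\dots,x_k$), then $w\Vdash_j P[\vec e]$; (2) if $(t,\vec d)Z(u,\vec e)$ with $t\in W_i$ and $u\leq_j v$, then there is $w\in W_i$ with $t\leq_i w$, $(w,\vec d)Z(v,\vec e)$ and $(v,\vec e)Z(w,\vec d)$; (3) if $t\in W_i$, $(t,\vec d)Z(u,\vec e)$ and $f\in D_i$, then there is $g\in D_j$ with $(t,\vec d f)Z(u,\vec e g)$; (4) if $t\in W_i$, $(t,\vec d)Z(u,\vec e)$ and $g\in D_j$, then there is $f\in D_i$ with $(t,\vec d f)Z(u,\vec e g)$. -}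

module Defs where

open import Data.Nat using (ℕ; suc)
open import Data.Fin using (Fin; fromℕ)
open import Data.Vec using (Vec; lookup; map; _∷ʳ_)
open import Data.Product using (Σ; _×_; _,_)
open import Data.Sum using (_⊎_)
open import Data.Empty using (⊥)

record Language : Set₁ where
  field
    Pred  : Set
    arity : Pred → ℕ

-- Formulas whose free variables are among x₁ … x_k (variable x_m is the
-- index m-1 : Fin k).  A quantifier binds the new variable x_{k+1}
-- (index fromℕ k), so the body lives in Formula (suc k).
data Formula (L : Language) (k : ℕ) : Set where
  atom : (P : Language.Pred L) → Vec (Fin k) (Language.arity L P) → Formula L k
  ⊥'   : Formula L k
  _∧'_ _∨'_ _⇒'_ : Formula L k → Formula L k → Formula L k
  ∀' ∃' : Formula L (suc k) → Formula L k

data IsAtomic {L : Language} {k : ℕ} : Formula L k → Set where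
  isAtom : ∀ P ts → IsAtomic (atom P ts)

record GModel (L : Language) : Set₁ where
  open Language L
  field
    W      : Set
    _≤_    : W → W → Set
    ≤-refl  : ∀ {u} → u ≤ u
    ≤-trans : ∀ {u v w} → u ≤ v → v ≤ w → u ≤ w
    root   : W
    root≤  : ∀ u → root ≤ u
    D      : Set
    inhab  : D
    φ      : (P : Pred) → W → Vec D (arity P) → Set
    φ-mono : ∀ P {u w} {as : Vec D (arity P)} → u ≤ w → φ P u as → φ P w as

module _ {L : Language} (M : GModel L) where
  open GModel M

  _⊩_[_] : ∀ {k} → W → Formula L k → Vec D k → Set
  u ⊩ atom P ts [ d ] = φ P u (map (lookup d) ts)
  u ⊩ ⊥' [ d ]        = ⊥
  u ⊩ A ∧' B [ d ]    = (u ⊩ A [ d ]) × (u ⊩ B [ d ])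
  u ⊩ A ∨' B [ d ]    = (u ⊩ A [ d ]) ⊎ (u ⊩ B [ d ])
  u ⊩ A ⇒' B [ d ]    = ∀ w → u ≤ w → w ⊩ A [ d ] → w ⊩ B [ d ]
  u ⊩ ∀' A [ d ]      = ∀ (a : D) → u ⊩ A [ d ∷ʳ a ]
  u ⊩ ∃' A [ d ]      = Σ D λ a → u ⊩ A [ d ∷ʳ a ]

Rel⟨_,_⟩ : ∀ {L} → GModel L → GModel L → Set₁
Rel⟨ M , N ⟩ = ∀ {k} → GModel.W M → Vec (GModel.D M) k → GModel.W N → Vec (GModel.D N) k → Set

-- Conditions (1)-(4) for one direction i → j.  Zij is the part of Z in
-- (Wᵢ×Dᵢᵏ)×(Wⱼ×Dⱼᵏ), Zji the part in (Wⱼ×Dⱼᵏ)×(Wᵢ×Dᵢᵏ).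
record AsimDir {L : Language} (Mi Mj : GModel L)
               (Zij : Rel⟨ Mi , Mj ⟩) (Zji : Rel⟨ Mj , Mi ⟩) : Set where
  module i = GModel Mi
  module j = GModel Mj
  field
    atomic : ∀ {k} {v : i.W} {d : Vec i.D k} {w : j.W} {e : Vec j.D k}
             (A : Formula L k) → IsAtomic A →
             Zij v d w e → _⊩_[_] Mi v A d → _⊩_[_] Mj w A e
    back   : ∀ {k} {t : i.W} {d : Vec i.D k} {u v : j.W} {e : Vec j.D k} →
             Zij t d u e → u j.≤ v →
             Σ i.W λ w → (t i.≤ w) × Zij w d v e × Zji v e w d
    forth  : ∀ {k} {t : i.W} {d : Vec i.D k} {u : j.W} {e : Vec j.D k} →
             Zij t d u e → (f : i.D) → Σ j.D λ g → Zij t (d ∷ʳ f) u (e ∷ʳ g)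
    back'  : ∀ {k} {t : i.W} {d : Vec i.D k} {u : j.W} {e : Vec j.D k} →
             Zij t d u e → (g : j.D) → Σ i.D λ f → Zij t (d ∷ʳ f) u (e ∷ʳ g)

-- A CD-asimulation between M₁ and M₂: Z = Z₁₂ ∪ Z₂₁ satisfying the
-- conditions for both {i,j} = {1,2}.
record CDAsimulation {L : Language} (M₁ M₂ : GModel L) : Set₁ where
  field
    Z₁₂ : Rel⟨ M₁ , M₂ ⟩
    Z₂₁ : Rel⟨ M₂ , M₁ ⟩
    dir₁₂ : AsimDir M₁ M₂ Z₁₂ Z₂₁
    dir₂₁ : AsimDir M₂ M₁ Z₂₁ Z₁₂

module Submission where

-- Say that a relation Zᵢⱼ from Mᵢ to Mⱼ "transfers" a formula A when
-- (t,d) Zᵢⱼ (u,e) and t ⊩ᵢ A[d] imply u ⊩ⱼ A[e].  For one direction i → j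
-- of an asimulation we show, connective by connective, that transfer is
-- inherited from the immediate subformulas: atoms by condition (1),
-- ∧ and ∨ pointwise, ∀ by condition (4), ∃ by condition (3).  The
-- implication is the only contravariant case: by condition (2) the
-- antecedent must be carried back along the reverse part Zⱼᵢ, so it needs
-- the transfer of A in the OPPOSITE direction.  The theorem is therefore
-- proved by a single induction on the formula establishing both directions
-- simultaneously; lemma4p1 just reads off the two components.

open import Defs
open import Data.Nat using (ℕ; suc)
open import Data.Fin using (Fin)
open import Data.Vec using (Vec)
open import Data.Product using (_×_; _,_)
open import Data.Sum using (inj₁; inj₂)

-- Zᵢⱼ transfers the formula A from Mᵢ to Mⱼ.  (A record rather than a
-- bare function type, so that Agda can infer Mᵢ, Mⱼ, Zᵢⱼ and A from it.)
record Transfers {L : Language} (Mi Mj : GModel L) (Zij : Rel⟨ Mi , Mj ⟩)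
                 {k : ℕ} (A : Formula L k) : Set where
  constructor transfers
  field
    transport : ∀ {t d u e} → Zij t d u e → _⊩_[_] Mi t A d → _⊩_[_] Mj u A e

open Transfers

∧-transfer : ∀ {L} {Mi Mj : GModel L} {Zij : Rel⟨ Mi , Mj ⟩} {k} {A B : Formula L k} →
             Transfers Mi Mj Zij A → Transfers Mi Mj Zij B → Transfers Mi Mj Zij (A ∧' B)
∧-transfer transA transB = transfers λ { z (tA , tB) → transport transA z tA , transport transB z tB }

∨-transfer : ∀ {L} {Mi Mj : GModel L} {Zij : Rel⟨ Mi , Mj ⟩} {k} {A B : Formula L k} →
             Transfers Mi Mj Zij A → Transfers Mi Mj Zij B → Transfers Mi Mj Zij (A ∨' B)
∨-transfer transA transB = transfers λ
  { z (inj₁ tA) → inj₁ (transport transA z tA)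
  ; z (inj₂ tB) → inj₂ (transport transB z tB) }

module OneDirection {L : Language} {Mi Mj : GModel L}
                    {Zij : Rel⟨ Mi , Mj ⟩} {Zji : Rel⟨ Mj , Mi ⟩}
                    (dir : AsimDir Mi Mj Zij Zji) where
  open AsimDir dir

  atom-transfer : ∀ {k} (P : Language.Pred L) (ts : Vec (Fin k) (Language.arity L P)) →
                  Transfers Mi Mj Zij (atom P ts)
  atom-transfer P ts = transfers (atomic (atom P ts) (isAtom P ts))

  -- Condition (2): a successor v ≥ u forcing A is matched by a successor
  -- w ≥ t related both ways to v; pull A back to w along Zⱼᵢ, apply the
  -- implication at w, and push B forward to v along Zᵢⱼ.
  ⇒-transfer : ∀ {k} {A B : Formula L k} →
               Transfers Mj Mi Zji A → Transfers Mi Mj Zij B → Transfers Mi Mj Zij (A ⇒' B)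
  ⇒-transfer pullA pushB = transfers λ z t⊩A⇒B v u≤v v⊩A →
    let (w , t≤w , zwv , zvw) = back z u≤v
    in transport pushB zwv (t⊩A⇒B w t≤w (transport pullA zvw v⊩A))

  ∀-transfer : ∀ {k} {A : Formula L (suc k)} →
               Transfers Mi Mj Zij A → Transfers Mi Mj Zij (∀' A)
  ∀-transfer transA = transfers λ z t⊩∀A g →
    let (f , z') = back' z g in transport transA z' (t⊩∀A f)

  ∃-transfer : ∀ {k} {A : Formula L (suc k)} →
               Transfers Mi Mj Zij A → Transfers Mi Mj Zij (∃' A)
  ∃-transfer transA = transfers λ { z (f , t⊩A) →
    let (g , z') = forth z f in g , transport transA z' t⊩A }

module _ {L : Language} {M₁ M₂ : GModel L} (Z : CDAsimulation M₁ M₂) where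
  open CDAsimulation Z
  private
    module D₁₂ = OneDirection dir₁₂
    module D₂₁ = OneDirection dir₂₁

  transfer : ∀ {k} (A : Formula L k) →
             Transfers M₁ M₂ Z₁₂ A × Transfers M₂ M₁ Z₂₁ A
  transfer (atom P ts) = D₁₂.atom-transfer P ts , D₂₁.atom-transfer P ts
  transfer ⊥'          = transfers (λ _ ()) , transfers (λ _ ())
  transfer (A ∧' B) with transfer A | transfer B
  ... | A₁₂ , A₂₁ | B₁₂ , B₂₁ = ∧-transfer A₁₂ B₁₂ , ∧-transfer A₂₁ B₂₁
  transfer (A ∨' B) with transfer A | transfer B
  ... | A₁₂ , A₂₁ | B₁₂ , B₂₁ = ∨-transfer A₁₂ B₁₂ , ∨-transfer A₂₁ B₂₁
  transfer (A ⇒' B) with transfer A | transfer B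
  ... | A₁₂ , A₂₁ | B₁₂ , B₂₁ = D₁₂.⇒-transfer A₂₁ B₁₂ , D₂₁.⇒-transfer A₁₂ B₂₁
  transfer (∀' A) with transfer A
  ... | A₁₂ , A₂₁ = D₁₂.∀-transfer A₁₂ , D₂₁.∀-transfer A₂₁
  transfer (∃' A) with transfer A
  ... | A₁₂ , A₂₁ = D₁₂.∃-transfer A₁₂ , D₂₁.∃-transfer A₂₁

lemma4p1 : {L : Language} (M₁ M₂ : GModel L) (Z : CDAsimulation M₁ M₂) (k : ℕ) (A : Formula L k) →
    (∀ (t : GModel.W M₁) (d : Vec (GModel.D M₁) k) (u : GModel.W M₂) (e : Vec (GModel.D M₂) k) →
       CDAsimulation.Z₁₂ Z t d u e → _⊩_[_] M₁ t A d → _⊩_[_] M₂ u A e)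
    × (∀ (t : GModel.W M₂) (d : Vec (GModel.D M₂) k) (u : GModel.W M₁) (e : Vec (GModel.D M₁) k) →
       CDAsimulation.Z₂₁ Z t d u e → _⊩_[_] M₂ t A d → _⊩_[_] M₁ u A e)
lemma4p1 M₁ M₂ Z k A with transfer Z A
... | trans₁₂ , trans₂₁ = (λ _ _ _ _ → transport trans₁₂) , (λ _ _ _ _ → transport trans₂₁)
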